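{- Let $(\mathcal V,1,\otimes)$ be a symmetric monoidal category with finite limits whose unit $1$ is a terminal object, let $\mathbb C,\mathbb D$ be internal categories in $\mathcal V$, and let $(\mathbb C\otimes\mathbb D)_0,(\mathbb C\otimes\mathbb D)_1,(\mathbb C\otimes\mathbb D)_2$ with $\mathit{dom},\mathit{cod},i,\mathit{comp}$ be as in the context. Then $\mathit{comp}\circ\langle i\circ\mathit{dom},\mathit{id}_{(\mathbb C\otimes\mathbb D)_1}\rangle=\mathit{id}_{(\mathbb C\otimes\mathbb D)_1}=\mathit{comp}\circ\langle\mathit{id}_{(\mathbb C\otimes\mathbb D)_1},i\circ\mathit{cod}\rangle,$ where $\langle-,-\rangle$ denotes the induced arrow into the pullback $(\mathbb C\otimes\mathbb D)_2$.
   Context: For objects $X,Y$ of $\mathcal V$, $j:X\otimes Y\to X\times Y$ denotes the canonical arrow whose components are $X\otimes Y\to X\otimes 1\cong X$ and $X\otimes Y\to 1\otimes Y\cong Y$. An internal category $\mathbb C$ in $\mathcal V$ consists of objects $\mathbb C_0,\mathbb C_1$, arrows $\mathit{dom},\mathit{cod}:\mathbb C_1\to\mathbb C_0$, $i:\mathbb C_0\to\mathbb C_1$, the pullback $\mathbb C_2$ of $\mathit{cod}$ and $\mathit{dom}$ with projections $\pi_1,\pi_2$, and $\mathit{comp}:\mathbb C_2\to\mathbb C_1$, satisfying $\mathit{dom}\circ i=\mathit{id}=\mathit{cod}\circ i$, $\mathit{dom}\circ\mathit{comp}=\mathit{dom}\circ\pi_1$, $\mathit{cod}\circ\mathit{comp}=\mathit{cod}\circ\pi_2$,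 the unit laws $\mathit{comp}\circ\langle i\circ\mathit{dom},\mathit{id}\rangle=\mathit{id}=\mathit{comp}\circ\langle\mathit{id},i\circ\mathit{cod}\rangle$ and associativity. Given internal categories $\mathbb C,\mathbb D$: $(\mathbb C\otimes\mathbb D)_0:=\mathbb C_0\otimes\mathbb D_0$; $(\mathbb C\otimes\mathbb D)_1$ is the limit, with arrows $\mathit{dom},\mathit{cod}:(\mathbb C\otimes\mathbb D)_1\to(\mathbb C\otimes\mathbb D)_0$ and $j_1:(\mathbb C\otimes\mathbb D)_1\to\mathbb C_1\times\mathbb D_1$, universal with $j\circ\mathit{dom}=(\mathit{dom}\times\mathit{dom})\circ j_1$ and $j\circ\mathit{cod}=(\mathit{cod}\times\mathit{cod})\circ j_1$; $(\mathbb C\otimes\mathbb D)_2$ is the pullback of $\mathit{cod}$ and $\mathit{dom}$ on $(\mathbb C\otimes\mathbb D)_1$ with projections $\pi_1,\pi_2$; $j_2:(\mathbb C\otimes\mathbb D)_2\to\mathbb C_2\times\mathbb D_2$ is the unique arrow with $(\pi_k\times\pi_k)\circ j_2=j_1\circ\pi_k$ ($k=1,2$), using that $\mathbb C_2\times\mathbb D_2$ is a pullback of $\mathit{cod}\times\mathit{cod}$ and $\mathit{dom}\times\mathit{dom}$. The arrow $i:(\mathbb C\otimes\mathbb D)_0\to(\mathbb C\otimes\mathbb D)_1$ is the unique arrow with $\mathit{dom}\circ i=\mathit{id}=\mathit{cod}\circ i$ and $j_1\circ i=(i\times i)\circ j$. The arrow $\mathit{comp}:(\mathbb C\otimes\mathbb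 D)_2\to(\mathbb C\otimes\mathbb D)_1$ is the unique arrow with $\mathit{dom}\circ\mathit{comp}=\mathit{dom}\circ\pi_1$, $\mathit{cod}\circ\mathit{comp}=\mathit{cod}\circ\pi_2$ and $j_1\circ\mathit{comp}=(\mathit{comp}\times\mathit{comp})\circ j_2$. -}

module Defs where

open import Level using (Level; _⊔_) renaming (suc to lsuc)
open import Relation.Binary using (Rel; IsEquivalence)

record Category (o ℓ e : Level) : Set (lsuc (o ⊔ ℓ ⊔ e)) where
  infixr 9 _∘_
  infix  4 _≈_
  infixr 4 _⇒_
  field
    Obj       : Set o
    _⇒_       : Obj → Obj → Set ℓ
    _≈_       : ∀ {A B} → Rel (A ⇒ B) e
    id        : ∀ {A} → A ⇒ A
    _∘_       : ∀ {A B C} → B ⇒ C → A ⇒ B → A ⇒ C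
    assoc     : ∀ {A B C D} {f : A ⇒ B} {g : B ⇒ C} {h : C ⇒ D} →
                (h ∘ g) ∘ f ≈ h ∘ (g ∘ f)
    identityˡ : ∀ {A B} {f : A ⇒ B} → id ∘ f ≈ f
    identityʳ : ∀ {A B} {f : A ⇒ B} → f ∘ id ≈ f
    equiv     : ∀ {A B} → IsEquivalence (_≈_ {A} {B})
    ∘-resp-≈  : ∀ {A B C} {f h : B ⇒ C} {g i : A ⇒ B} →
                f ≈ h → g ≈ i → f ∘ g ≈ h ∘ i

module CatLemmas {o ℓ e} (𝒞 : Category o ℓ e) where
  open Category 𝒞

  ≈-refl : ∀ {A B} {f : A ⇒ B} → f ≈ f
  ≈-refl = IsEquivalence.refl equiv

  ≈-sym : ∀ {A B} {f g : A ⇒ B} → f ≈ g → g ≈ f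
  ≈-sym = IsEquivalence.sym equiv

  ≈-trans : ∀ {A B} {f g h : A ⇒ B} → f ≈ g → g ≈ h → f ≈ h
  ≈-trans = IsEquivalence.trans equiv

  ∘ˡ : ∀ {A B C} {h : B ⇒ C} {f g : A ⇒ B} → f ≈ g → h ∘ f ≈ h ∘ g
  ∘ˡ p = ∘-resp-≈ ≈-refl p

  ∘ʳ : ∀ {A B C} {h : A ⇒ B} {f g : B ⇒ C} → f ≈ g → f ∘ h ≈ g ∘ h
  ∘ʳ p = ∘-resp-≈ p ≈-refl

  cancelˡ : ∀ {A B C} {a : B ⇒ A} {b : A ⇒ B} {c : C ⇒ A} →
            a ∘ b ≈ id → a ∘ (b ∘ c) ≈ c
  cancelˡ p = ≈-trans (≈-sym assoc) (≈-trans (∘ʳ p) identityˡ)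

  pullˡ : ∀ {A B B' C D} {a : B ⇒ C} {b : A ⇒ B} {c : B' ⇒ C} {d : A ⇒ B'}
            {q : D ⇒ A} → a ∘ b ≈ c ∘ d → a ∘ (b ∘ q) ≈ c ∘ (d ∘ q)
  pullˡ p = ≈-trans (≈-sym assoc) (≈-trans (∘ʳ p) assoc)

module _ {o ℓ e} (𝒞 : Category o ℓ e) where
  open Category 𝒞

  record IsTerminal (T : Obj) : Set (o ⊔ ℓ ⊔ e) where
    field
      !        : ∀ {A} → A ⇒ T
      !-unique : ∀ {A} (f : A ⇒ T) → ! ≈ f

  record Product (A B : Obj) : Set (o ⊔ ℓ ⊔ e) where
    field
      A×B      : Obj
      π₁       : A×B ⇒ A
      π₂       : A×B ⇒ B
      ⟨_,_⟩    : ∀ {X} → X ⇒ A → X ⇒ B → X ⇒ A×B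
      project₁ : ∀ {X} {f : X ⇒ A} {g : X ⇒ B} → π₁ ∘ ⟨ f , g ⟩ ≈ f
      project₂ : ∀ {X} {f : X ⇒ A} {g : X ⇒ B} → π₂ ∘ ⟨ f , g ⟩ ≈ g
      unique   : ∀ {X} {h : X ⇒ A×B} {f : X ⇒ A} {g : X ⇒ B} →
                 π₁ ∘ h ≈ f → π₂ ∘ h ≈ g → ⟨ f , g ⟩ ≈ h

  record Pullback {A B C : Obj} (f : A ⇒ C) (g : B ⇒ C) : Set (o ⊔ ℓ ⊔ e) where
    field
      P          : Obj
      p₁         : P ⇒ A
      p₂         : P ⇒ B
      commute    : f ∘ p₁ ≈ g ∘ p₂
      universal  : ∀ {X} {h₁ : X ⇒ A} {h₂ : X ⇒ B} → f ∘ h₁ ≈ g ∘ h₂ → X ⇒ P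
      p₁∘universal≈h₁ : ∀ {X} {h₁ : X ⇒ A} {h₂ : X ⇒ B} (eq : f ∘ h₁ ≈ g ∘ h₂) →
                        p₁ ∘ universal eq ≈ h₁
      p₂∘universal≈h₂ : ∀ {X} {h₁ : X ⇒ A} {h₂ : X ⇒ B} (eq : f ∘ h₁ ≈ g ∘ h₂) →
                        p₂ ∘ universal eq ≈ h₂
      unique     : ∀ {X} {h₁ : X ⇒ A} {h₂ : X ⇒ B} (eq : f ∘ h₁ ≈ g ∘ h₂)
                   {u : X ⇒ P} → p₁ ∘ u ≈ h₁ → p₂ ∘ u ≈ h₂ → u ≈ universal eq

  record FiniteLimits : Set (o ⊔ ℓ ⊔ e) where
    field
      ⊤          : Obj
      ⊤-terminal : IsTerminal ⊤
      product    : ∀ A B → Product A B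
      pullback   : ∀ {A B C} (f : A ⇒ C) (g : B ⇒ C) → Pullback f g

  record Monoidal : Set (o ⊔ ℓ ⊔ e) where
    infixr 10 _⊗₀_ _⊗₁_
    field
      _⊗₀_ : Obj → Obj → Obj
      _⊗₁_ : ∀ {A B C D} → A ⇒ B → C ⇒ D → A ⊗₀ C ⇒ B ⊗₀ D
      ⊗-identity     : ∀ {A B} → id {A} ⊗₁ id {B} ≈ id
      ⊗-homomorphism : ∀ {A B C D E F} {f : B ⇒ C} {g : A ⇒ B} {h : E ⇒ F} {k : D ⇒ E} →
                       (f ∘ g) ⊗₁ (h ∘ k) ≈ (f ⊗₁ h) ∘ (g ⊗₁ k)
      ⊗-resp-≈       : ∀ {A B C D} {f g : A ⇒ B} {h k : C ⇒ D} →
                       f ≈ g → h ≈ k → f ⊗₁ h ≈ g ⊗₁ k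
      unit : Obj
      unitorˡ⇒ : ∀ {A} → unit ⊗₀ A ⇒ A
      unitorˡ⇐ : ∀ {A} → A ⇒ unit ⊗₀ A
      unitorˡ-isoˡ : ∀ {A} → unitorˡ⇐ ∘ unitorˡ⇒ ≈ id {unit ⊗₀ A}
      unitorˡ-isoʳ : ∀ {A} → unitorˡ⇒ ∘ unitorˡ⇐ ≈ id {A}
      unitorˡ-natural : ∀ {A B} {f : A ⇒ B} → unitorˡ⇒ ∘ (id ⊗₁ f) ≈ f ∘ unitorˡ⇒
      unitorʳ⇒ : ∀ {A} → A ⊗₀ unit ⇒ A
      unitorʳ⇐ : ∀ {A} → A ⇒ A ⊗₀ unit
      unitorʳ-isoˡ : ∀ {A} → unitorʳ⇐ ∘ unitorʳ⇒ ≈ id {A ⊗₀ unit}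
      unitorʳ-isoʳ : ∀ {A} → unitorʳ⇒ ∘ unitorʳ⇐ ≈ id {A}
      unitorʳ-natural : ∀ {A B} {f : A ⇒ B} → unitorʳ⇒ ∘ (f ⊗₁ id) ≈ f ∘ unitorʳ⇒
      associator⇒ : ∀ {A B C} → (A ⊗₀ B) ⊗₀ C ⇒ A ⊗₀ (B ⊗₀ C)
      associator⇐ : ∀ {A B C} → A ⊗₀ (B ⊗₀ C) ⇒ (A ⊗₀ B) ⊗₀ C
      associator-isoˡ : ∀ {A B C} → associator⇐ ∘ associator⇒ ≈ id {(A ⊗₀ B) ⊗₀ C}
      associator-isoʳ : ∀ {A B C} → associator⇒ ∘ associator⇐ ≈ id {A ⊗₀ (B ⊗₀ C)}
      associator-natural : ∀ {A B C D E F} {f : A ⇒ D} {g : B ⇒ E} {h : C ⇒ F} →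
                           associator⇒ ∘ ((f ⊗₁ g) ⊗₁ h) ≈ (f ⊗₁ (g ⊗₁ h)) ∘ associator⇒
      triangle : ∀ {A B} →
                 (id {A} ⊗₁ unitorˡ⇒ {B}) ∘ associator⇒ ≈ unitorʳ⇒ ⊗₁ id
      pentagon : ∀ {A B C D} →
                 (id {A} ⊗₁ associator⇒ {B} {C} {D}) ∘ (associator⇒ ∘ (associator⇒ ⊗₁ id))
                   ≈ associator⇒ ∘ associator⇒

  record Symmetric (M : Monoidal) : Set (o ⊔ ℓ ⊔ e) where
    open Monoidal M
    field
      braiding : ∀ {A B} → A ⊗₀ B ⇒ B ⊗₀ A
      braiding-natural : ∀ {A B C D} {f : A ⇒ B} {g : C ⇒ D} →
                         braiding ∘ (f ⊗₁ g) ≈ (g ⊗₁ f) ∘ braiding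
      commutative : ∀ {A B} → braiding {B} {A} ∘ braiding {A} {B} ≈ id
      hexagon : ∀ {A B C} →
                associator⇒ {B} {C} {A} ∘ (braiding ∘ associator⇒)
                  ≈ (id ⊗₁ braiding) ∘ (associator⇒ ∘ (braiding ⊗₁ id))

record SMCFiniteLimits (o ℓ e : Level) : Set (lsuc (o ⊔ ℓ ⊔ e)) where
  field
    cat           : Category o ℓ e
    monoidal      : Monoidal cat
    symmetric     : Symmetric cat monoidal
    finiteLimits  : FiniteLimits cat
    unit-terminal : IsTerminal cat (Monoidal.unit monoidal)

module VStuff {o ℓ e} (V : SMCFiniteLimits o ℓ e) where
  open SMCFiniteLimits V public
  open Category cat public
  open CatLemmas cat public
  open Monoidal monoidal public
  open FiniteLimits finiteLimits public using (product; pullback)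
  open IsTerminal unit-terminal public using (!)

  infixr 7 _×ᵥ_ _×₁_
  _×ᵥ_ : Obj → Obj → Obj
  A ×ᵥ B = Product.A×B (product A B)

  πˡ : ∀ {A B} → A ×ᵥ B ⇒ A
  πˡ {A} {B} = Product.π₁ (product A B)

  πʳ : ∀ {A B} → A ×ᵥ B ⇒ B
  πʳ {A} {B} = Product.π₂ (product A B)

  ⟪_,_⟫ : ∀ {X A B} → X ⇒ A → X ⇒ B → X ⇒ A ×ᵥ B
  ⟪_,_⟫ {A = A} {B} = Product.⟨_,_⟩ (product A B)

  _×₁_ : ∀ {A B C D} → A ⇒ B → C ⇒ D → A ×ᵥ C ⇒ B ×ᵥ D
  f ×₁ g = ⟪ f ∘ πˡ , g ∘ πʳ ⟫

  j : ∀ {X Y} → X ⊗₀ Y ⇒ X ×ᵥ Y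
  j = ⟪ unitorʳ⇒ ∘ (id ⊗₁ !) , unitorˡ⇒ ∘ (! ⊗₁ id) ⟫

module _ {o ℓ e} (V : SMCFiniteLimits o ℓ e) where
  open VStuff V

  record InternalCategory : Set (o ⊔ ℓ ⊔ e) where
    field
      C₀ C₁    : Obj
      dom cod  : C₁ ⇒ C₀
      i        : C₀ ⇒ C₁
      C₂       : Pullback cat cod dom
    open Pullback C₂ public using () renaming (P to C₂P; p₁ to π₁; p₂ to π₂)
    field
      comp     : C₂P ⇒ C₁
      dom∘i    : dom ∘ i ≈ id
      cod∘i    : cod ∘ i ≈ id
      dom∘comp : dom ∘ comp ≈ dom ∘ π₁
      cod∘comp : cod ∘ comp ≈ cod ∘ π₂
    ⟨i∘dom,id⟩ : C₁ ⇒ C₂P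
    ⟨i∘dom,id⟩ = Pullback.universal C₂ {h₁ = i ∘ dom} {h₂ = id}
                   (≈-trans (cancelˡ cod∘i) (≈-sym identityʳ))
    ⟨id,i∘cod⟩ : C₁ ⇒ C₂P
    ⟨id,i∘cod⟩ = Pullback.universal C₂ {h₁ = id} {h₂ = i ∘ cod}
                   (≈-trans identityʳ (≈-sym (cancelˡ dom∘i)))
    C₃ : Pullback cat π₂ π₁
    C₃ = pullback π₂ π₁
    private
      q₁ = Pullback.p₁ C₃
      q₂ = Pullback.p₂ C₃
      qc = Pullback.commute C₃
      pc = Pullback.commute C₂
    comp×id : Pullback.P C₃ ⇒ C₂P
    comp×id = Pullback.universal C₂ {h₁ = comp ∘ q₁} {h₂ = π₂ ∘ q₂}
                (≈-trans (pullˡ cod∘comp) (≈-trans (∘ˡ qc) (pullˡ pc)))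
    id×comp : Pullback.P C₃ ⇒ C₂P
    id×comp = Pullback.universal C₂ {h₁ = π₁ ∘ q₁} {h₂ = comp ∘ q₂}
                (≈-trans (pullˡ pc) (≈-trans (∘ˡ qc) (pullˡ (≈-sym dom∘comp))))
    field
      identityˡ : comp ∘ ⟨i∘dom,id⟩ ≈ id
      identityʳ : comp ∘ ⟨id,i∘cod⟩ ≈ id
      assoc     : comp ∘ comp×id ≈ comp ∘ id×comp

-- (C ⊗ D)₁ : a limit with dom, cod : (C⊗D)₁ → C₀ ⊗ D₀ and
-- j₁ : (C⊗D)₁ → C₁ × D₁, universal with
--   j ∘ dom ≈ (dom × dom) ∘ j₁ ,  j ∘ cod ≈ (cod × cod) ∘ j₁

module _ {o ℓ e} (V : SMCFiniteLimits o ℓ e) (C D : InternalCategory V) where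
  open VStuff V
  private
    module C = InternalCategory C
    module D = InternalCategory D

  record TensorOne : Set (o ⊔ ℓ ⊔ e) where
    field
      T₁      : Obj
      dom cod : T₁ ⇒ C.C₀ ⊗₀ D.C₀
      j₁      : T₁ ⇒ C.C₁ ×ᵥ D.C₁
      j∘dom   : j ∘ dom ≈ (C.dom ×₁ D.dom) ∘ j₁
      j∘cod   : j ∘ cod ≈ (C.cod ×₁ D.cod) ∘ j₁
      universal : ∀ {X} (d c : X ⇒ C.C₀ ⊗₀ D.C₀) (h : X ⇒ C.C₁ ×ᵥ D.C₁) →
                  j ∘ d ≈ (C.dom ×₁ D.dom) ∘ h → j ∘ c ≈ (C.cod ×₁ D.cod) ∘ h →
                  X ⇒ T₁
      dom∘universal : ∀ {X} {d c : X ⇒ C.C₀ ⊗₀ D.C₀} {h : X ⇒ C.C₁ ×ᵥ D.C₁}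
                      (ed : j ∘ d ≈ (C.dom ×₁ D.dom) ∘ h) (ec : j ∘ c ≈ (C.cod ×₁ D.cod) ∘ h) →
                      dom ∘ universal d c h ed ec ≈ d
      cod∘universal : ∀ {X} {d c : X ⇒ C.C₀ ⊗₀ D.C₀} {h : X ⇒ C.C₁ ×ᵥ D.C₁}
                      (ed : j ∘ d ≈ (C.dom ×₁ D.dom) ∘ h) (ec : j ∘ c ≈ (C.cod ×₁ D.cod) ∘ h) →
                      cod ∘ universal d c h ed ec ≈ c
      j₁∘universal  : ∀ {X} {d c : X ⇒ C.C₀ ⊗₀ D.C₀} {h : X ⇒ C.C₁ ×ᵥ D.C₁}
                      (ed : j ∘ d ≈ (C.dom ×₁ D.dom) ∘ h) (ec : j ∘ c ≈ (C.cod ×₁ D.cod) ∘ h) →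
                      j₁ ∘ universal d c h ed ec ≈ h
      unique        : ∀ {X} {d c : X ⇒ C.C₀ ⊗₀ D.C₀} {h : X ⇒ C.C₁ ×ᵥ D.C₁}
                      (ed : j ∘ d ≈ (C.dom ×₁ D.dom) ∘ h) (ec : j ∘ c ≈ (C.cod ×₁ D.cod) ∘ h)
                      {u : X ⇒ T₁} → dom ∘ u ≈ d → cod ∘ u ≈ c → j₁ ∘ u ≈ h →
                      u ≈ universal d c h ed ec

-- (C ⊗ D)₁ is a limit, so an endomorphism of it is the identity as soon as its dom-, cod-
-- and j₁-components are. For comp ∘ ⟨ i ∘ dom , id ⟩ the first two follow from i being a
-- section of dom and cod. The j₁-component splits along C₁ × D₁ into a C- and a
-- D-component, and since j, j₁ and j₂ intertwine dom, cod, i and the projections of the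
-- two pullbacks, each of these is comp applied to a unit pair of C (resp. D), hence the
-- identity by the unit laws of C and D. The other unit law is symmetric.
module Submission where

open import Data.Product using (_×_; _,_)
open import Relation.Binary.Bundles using (Setoid)
import Relation.Binary.Reasoning.Setoid as SetoidReasoning

open import Defs

module CategoryProperties {o ℓ e} (𝒞 : Category o ℓ e) where
  open Category 𝒞
  open CatLemmas 𝒞

  hom-setoid : Obj → Obj → Setoid ℓ e
  hom-setoid A B = record { Carrier = A ⇒ B ; _≈_ = _≈_ ; isEquivalence = equiv }

  module HomReasoning {A B : Obj} = SetoidReasoning (hom-setoid A B)

  pullback-unique-diagram : ∀ {A B C X} {f : A ⇒ C} {g : B ⇒ C} (P : Pullback 𝒞 f g)
                            {a b : X ⇒ Pullback.P P} →
                            Pullback.p₁ P ∘ a ≈ Pullback.p₁ P ∘ b →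
                            Pullback.p₂ P ∘ a ≈ Pullback.p₂ P ∘ b → a ≈ b
  pullback-unique-diagram P e₁ e₂ =
    ≈-trans (unique (pullˡ commute) e₁ e₂) (≈-sym (unique (pullˡ commute) ≈-refl ≈-refl))
    where open Pullback P

  product-unique-diagram : ∀ {A B X} (P : Product 𝒞 A B) {a b : X ⇒ Product.A×B P} →
                           Product.π₁ P ∘ a ≈ Product.π₁ P ∘ b →
                           Product.π₂ P ∘ a ≈ Product.π₂ P ∘ b → a ≈ b
  product-unique-diagram P e₁ e₂ =
    ≈-trans (≈-sym (unique ≈-refl ≈-refl)) (unique (≈-sym e₁) (≈-sym e₂))
    where open Product P

  module _ {A B C : Obj} {f : A ⇒ C} {g : B ⇒ C} (P : Pullback 𝒞 f g)
           {X Y} {h₁ : X ⇒ A} {h₂ : X ⇒ B} (eq : f ∘ h₁ ≈ g ∘ h₂) {q : Y ⇒ X} where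
    open Pullback P

    p₁∘universal∘ : p₁ ∘ (universal eq ∘ q) ≈ h₁ ∘ q
    p₁∘universal∘ = ≈-trans (≈-sym assoc) (∘ʳ (p₁∘universal≈h₁ eq))

    p₂∘universal∘ : p₂ ∘ (universal eq ∘ q) ≈ h₂ ∘ q
    p₂∘universal∘ = ≈-trans (≈-sym assoc) (∘ʳ (p₂∘universal≈h₂ eq))

module _ {o ℓ e} (V : SMCFiniteLimits o ℓ e) where
  open VStuff V
  open CategoryProperties cat
  open HomReasoning

  module _ {A B C D X} {f : A ⇒ B} {g : C ⇒ D} {h : X ⇒ A ×ᵥ C} where

    πˡ∘×₁ : πˡ ∘ ((f ×₁ g) ∘ h) ≈ f ∘ (πˡ ∘ h)
    πˡ∘×₁ = pullˡ (Product.project₁ (product B D))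

    πʳ∘×₁ : πʳ ∘ ((f ×₁ g) ∘ h) ≈ g ∘ (πʳ ∘ h)
    πʳ∘×₁ = pullˡ (Product.project₂ (product B D))

    πˡ-×₁-square : ∀ {k : X ⇒ B ×ᵥ D} → (f ×₁ g) ∘ h ≈ k → f ∘ (πˡ ∘ h) ≈ πˡ ∘ k
    πˡ-×₁-square sq = ≈-trans (≈-sym πˡ∘×₁) (∘ˡ sq)

    πʳ-×₁-square : ∀ {k : X ⇒ B ×ᵥ D} → (f ×₁ g) ∘ h ≈ k → g ∘ (πʳ ∘ h) ≈ πʳ ∘ k
    πʳ-×₁-square sq = ≈-trans (≈-sym πʳ∘×₁) (∘ˡ sq)

    ×₁-square : ∀ {k : X ⇒ B ×ᵥ D} →
                f ∘ (πˡ ∘ h) ≈ πˡ ∘ k → g ∘ (πʳ ∘ h) ≈ πʳ ∘ k → (f ×₁ g) ∘ h ≈ k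
    ×₁-square sqˡ sqʳ =
      product-unique-diagram (product B D) (≈-trans πˡ∘×₁ sqˡ) (≈-trans πʳ∘×₁ sqʳ)

  module InternalCategoryProperties (E : InternalCategory V) where
    private module E = InternalCategory E

    comp-unitˡ : ∀ {X} {f : X ⇒ E.C₁} {u : X ⇒ E.C₂P} →
                 E.π₁ ∘ u ≈ E.i ∘ (E.dom ∘ f) → E.π₂ ∘ u ≈ f → E.comp ∘ u ≈ f
    comp-unitˡ {f = f} {u} e₁ e₂ = begin
      E.comp ∘ u                   ≈⟨ ∘ˡ u≈⟨i∘dom,id⟩∘f ⟩
      E.comp ∘ (E.⟨i∘dom,id⟩ ∘ f)  ≈⟨ assoc ⟨
      (E.comp ∘ E.⟨i∘dom,id⟩) ∘ f  ≈⟨ ∘ʳ E.identityˡ ⟩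
      id ∘ f                       ≈⟨ identityˡ ⟩
      f                            ∎
      where
      u≈⟨i∘dom,id⟩∘f : u ≈ E.⟨i∘dom,id⟩ ∘ f
      u≈⟨i∘dom,id⟩∘f = pullback-unique-diagram E.C₂
        (≈-trans e₁ (≈-trans (≈-sym assoc) (≈-sym (p₁∘universal∘ E.C₂ _))))
        (≈-trans e₂ (≈-trans (≈-sym identityˡ) (≈-sym (p₂∘universal∘ E.C₂ _))))

    comp-unitʳ : ∀ {X} {f : X ⇒ E.C₁} {u : X ⇒ E.C₂P} →
                 E.π₁ ∘ u ≈ f → E.π₂ ∘ u ≈ E.i ∘ (E.cod ∘ f) → E.comp ∘ u ≈ f
    comp-unitʳ {f = f} {u} e₁ e₂ = begin
      E.comp ∘ u                   ≈⟨ ∘ˡ u≈⟨id,i∘cod⟩∘f ⟩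
      E.comp ∘ (E.⟨id,i∘cod⟩ ∘ f)  ≈⟨ assoc ⟨
      (E.comp ∘ E.⟨id,i∘cod⟩) ∘ f  ≈⟨ ∘ʳ E.identityʳ ⟩
      id ∘ f                       ≈⟨ identityˡ ⟩
      f                            ∎
      where
      u≈⟨id,i∘cod⟩∘f : u ≈ E.⟨id,i∘cod⟩ ∘ f
      u≈⟨id,i∘cod⟩∘f = pullback-unique-diagram E.C₂
        (≈-trans e₁ (≈-trans (≈-sym identityˡ) (≈-sym (p₁∘universal∘ E.C₂ _))))
        (≈-trans e₂ (≈-trans (≈-sym assoc) (≈-sym (p₂∘universal∘ E.C₂ _))))

  -- The squares say that (J₀, J₁, J₂) is a morphism from the reflexive graph G, with its
  -- object G₂ of composable pairs, to the underlying reflexive graph of E.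
  module UnitPairs (E : InternalCategory V) {O G : Obj} {dT cT : G ⇒ O} (iT : O ⇒ G)
           (G₂ : Pullback cat cT dT)
           {J₀ : O ⇒ InternalCategory.C₀ E} {J₁ : G ⇒ InternalCategory.C₁ E}
           {J₂ : Pullback.P G₂ ⇒ InternalCategory.C₂P E}
           (dom-square : InternalCategory.dom E ∘ J₁ ≈ J₀ ∘ dT)
           (cod-square : InternalCategory.cod E ∘ J₁ ≈ J₀ ∘ cT)
           (i-square : InternalCategory.i E ∘ J₀ ≈ J₁ ∘ iT)
           (π₁-square : InternalCategory.π₁ E ∘ J₂ ≈ J₁ ∘ Pullback.p₁ G₂)
           (π₂-square : InternalCategory.π₂ E ∘ J₂ ≈ J₁ ∘ Pullback.p₂ G₂) where
    private
      module E = InternalCategory E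
      module G₂ = Pullback G₂
    open InternalCategoryProperties E

    comp∘J₂-unitˡ : ∀ {v : G ⇒ G₂.P} → G₂.p₁ ∘ v ≈ iT ∘ dT → G₂.p₂ ∘ v ≈ id →
                    E.comp ∘ (J₂ ∘ v) ≈ J₁
    comp∘J₂-unitˡ {v} e₁ e₂ = comp-unitˡ
      (begin
        E.π₁ ∘ (J₂ ∘ v)      ≈⟨ pullˡ π₁-square ⟩
        J₁ ∘ (G₂.p₁ ∘ v)     ≈⟨ ∘ˡ e₁ ⟩
        J₁ ∘ (iT ∘ dT)       ≈⟨ pullˡ i-square ⟨
        E.i ∘ (J₀ ∘ dT)      ≈⟨ ∘ˡ dom-square ⟨
        E.i ∘ (E.dom ∘ J₁)   ∎)
      (begin
        E.π₂ ∘ (J₂ ∘ v)      ≈⟨ pullˡ π₂-square ⟩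
        J₁ ∘ (G₂.p₂ ∘ v)     ≈⟨ ∘ˡ e₂ ⟩
        J₁ ∘ id              ≈⟨ identityʳ ⟩
        J₁                   ∎)

    comp∘J₂-unitʳ : ∀ {v : G ⇒ G₂.P} → G₂.p₁ ∘ v ≈ id → G₂.p₂ ∘ v ≈ iT ∘ cT →
                    E.comp ∘ (J₂ ∘ v) ≈ J₁
    comp∘J₂-unitʳ {v} e₁ e₂ = comp-unitʳ
      (begin
        E.π₁ ∘ (J₂ ∘ v)      ≈⟨ pullˡ π₁-square ⟩
        J₁ ∘ (G₂.p₁ ∘ v)     ≈⟨ ∘ˡ e₁ ⟩
        J₁ ∘ id              ≈⟨ identityʳ ⟩
        J₁                   ∎)
      (begin
        E.π₂ ∘ (J₂ ∘ v)      ≈⟨ pullˡ π₂-square ⟩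
        J₁ ∘ (G₂.p₂ ∘ v)     ≈⟨ ∘ˡ e₂ ⟩
        J₁ ∘ (iT ∘ cT)       ≈⟨ pullˡ i-square ⟨
        E.i ∘ (J₀ ∘ cT)      ≈⟨ ∘ˡ cod-square ⟨
        E.i ∘ (E.cod ∘ J₁)   ∎)

  module TensorOneProperties {C D : InternalCategory V} (T : TensorOne V C D) where
    private
      module C = InternalCategory C
      module D = InternalCategory D
      module T = TensorOne T

    T₂ : Pullback cat T.cod T.dom
    T₂ = pullback T.cod T.dom

    private module T₂ = Pullback T₂

    unique-diagram : ∀ {X} {a b : X ⇒ T.T₁} → T.dom ∘ a ≈ T.dom ∘ b → T.cod ∘ a ≈ T.cod ∘ b →
                     T.j₁ ∘ a ≈ T.j₁ ∘ b → a ≈ b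
    unique-diagram e₁ e₂ e₃ =
      ≈-trans (T.unique (pullˡ T.j∘dom) (pullˡ T.j∘cod) e₁ e₂ e₃)
              (≈-sym (T.unique (pullˡ T.j∘dom) (pullˡ T.j∘cod) ≈-refl ≈-refl ≈-refl))

    module UnitLaws (j₂ : T₂.P ⇒ C.C₂P ×ᵥ D.C₂P)
             (π₁-j₂ : (C.π₁ ×₁ D.π₁) ∘ j₂ ≈ T.j₁ ∘ T₂.p₁)
             (π₂-j₂ : (C.π₂ ×₁ D.π₂) ∘ j₂ ≈ T.j₁ ∘ T₂.p₂)
             (iT : C.C₀ ⊗₀ D.C₀ ⇒ T.T₁)
             (j₁-iT : T.j₁ ∘ iT ≈ (C.i ×₁ D.i) ∘ j)
             (compT : T₂.P ⇒ T.T₁)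
             (dom-compT : T.dom ∘ compT ≈ T.dom ∘ T₂.p₁)
             (cod-compT : T.cod ∘ compT ≈ T.cod ∘ T₂.p₂)
             (j₁-compT : T.j₁ ∘ compT ≈ (C.comp ×₁ D.comp) ∘ j₂) where
      private
        module Cᵘ = UnitPairs C iT T₂ {J₀ = πˡ ∘ j} {πˡ ∘ T.j₁} {πˡ ∘ j₂}
          (≈-trans (πˡ-×₁-square (≈-sym T.j∘dom)) (≈-sym assoc))
          (≈-trans (πˡ-×₁-square (≈-sym T.j∘cod)) (≈-sym assoc))
          (≈-trans (πˡ-×₁-square (≈-sym j₁-iT)) (≈-sym assoc))
          (≈-trans (πˡ-×₁-square π₁-j₂) (≈-sym assoc))
          (≈-trans (πˡ-×₁-square π₂-j₂) (≈-sym assoc))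
        module Dᵘ = UnitPairs D iT T₂ {J₀ = πʳ ∘ j} {πʳ ∘ T.j₁} {πʳ ∘ j₂}
          (≈-trans (πʳ-×₁-square (≈-sym T.j∘dom)) (≈-sym assoc))
          (≈-trans (πʳ-×₁-square (≈-sym T.j∘cod)) (≈-sym assoc))
          (≈-trans (πʳ-×₁-square (≈-sym j₁-iT)) (≈-sym assoc))
          (≈-trans (πʳ-×₁-square π₁-j₂) (≈-sym assoc))
          (≈-trans (πʳ-×₁-square π₂-j₂) (≈-sym assoc))

      j₁∘compT : ∀ {v : T.T₁ ⇒ T₂.P} →
                 C.comp ∘ ((πˡ ∘ j₂) ∘ v) ≈ πˡ ∘ T.j₁ → D.comp ∘ ((πʳ ∘ j₂) ∘ v) ≈ πʳ ∘ T.j₁ →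
                 T.j₁ ∘ (compT ∘ v) ≈ T.j₁ ∘ id
      j₁∘compT {v} eᶜ eᵈ = begin
        T.j₁ ∘ (compT ∘ v)              ≈⟨ pullˡ j₁-compT ⟩
        (C.comp ×₁ D.comp) ∘ (j₂ ∘ v)   ≈⟨ ×₁-square (≈-trans (∘ˡ (≈-sym assoc)) eᶜ)
                                                      (≈-trans (∘ˡ (≈-sym assoc)) eᵈ) ⟩
        T.j₁                            ≈⟨ identityʳ ⟨
        T.j₁ ∘ id                       ∎

      compT-unitˡ : T.dom ∘ iT ≈ id → ∀ {v : T.T₁ ⇒ T₂.P} →
                    T₂.p₁ ∘ v ≈ iT ∘ T.dom → T₂.p₂ ∘ v ≈ id → compT ∘ v ≈ id
      compT-unitˡ dom-iT e₁ e₂ = unique-diagram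
        (≈-trans (pullˡ dom-compT) (≈-trans (∘ˡ e₁) (≈-trans (cancelˡ dom-iT) (≈-sym identityʳ))))
        (≈-trans (pullˡ cod-compT) (∘ˡ e₂))
        (j₁∘compT (Cᵘ.comp∘J₂-unitˡ e₁ e₂) (Dᵘ.comp∘J₂-unitˡ e₁ e₂))

      compT-unitʳ : T.cod ∘ iT ≈ id → ∀ {v : T.T₁ ⇒ T₂.P} →
                    T₂.p₁ ∘ v ≈ id → T₂.p₂ ∘ v ≈ iT ∘ T.cod → compT ∘ v ≈ id
      compT-unitʳ cod-iT e₁ e₂ = unique-diagram
        (≈-trans (pullˡ dom-compT) (∘ˡ e₁))
        (≈-trans (pullˡ cod-compT) (≈-trans (∘ˡ e₂) (≈-trans (cancelˡ cod-iT) (≈-sym identityʳ))))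
        (j₁∘compT (Cᵘ.comp∘J₂-unitʳ e₁ e₂) (Dᵘ.comp∘J₂-unitʳ e₁ e₂))

mainTheorem2 :
  ∀ {o ℓ e} (V : SMCFiniteLimits o ℓ e) (C D : InternalCategory V) (T : TensorOne V C D) →
    let open VStuff V
        module C = InternalCategory C
        module D = InternalCategory D
        module T = TensorOne T
        T₂ = pullback T.cod T.dom
        module T₂ = Pullback T₂
    in (j₂ : T₂.P ⇒ C.C₂P ×ᵥ D.C₂P) →
       (C.π₁ ×₁ D.π₁) ∘ j₂ ≈ T.j₁ ∘ T₂.p₁ →
       (C.π₂ ×₁ D.π₂) ∘ j₂ ≈ T.j₁ ∘ T₂.p₂ →
       (iT : C.C₀ ⊗₀ D.C₀ ⇒ T.T₁) →
       (dom∘iT : T.dom ∘ iT ≈ id) →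
       (cod∘iT : T.cod ∘ iT ≈ id) →
       T.j₁ ∘ iT ≈ (C.i ×₁ D.i) ∘ j →
       (compT : T₂.P ⇒ T.T₁) →
       T.dom ∘ compT ≈ T.dom ∘ T₂.p₁ →
       T.cod ∘ compT ≈ T.cod ∘ T₂.p₂ →
       T.j₁ ∘ compT ≈ (C.comp ×₁ D.comp) ∘ j₂ →
       (compT ∘ T₂.universal {h₁ = iT ∘ T.dom} {h₂ = id}
                  (≈-trans (cancelˡ cod∘iT) (≈-sym identityʳ))
          ≈ id)
       ×
       (id ≈ compT ∘ T₂.universal {h₁ = id} {h₂ = iT ∘ T.cod}
                       (≈-trans identityʳ (≈-sym (cancelˡ dom∘iT))))
mainTheorem2 V C D T j₂ π₁-j₂ π₂-j₂ iT dom-iT cod-iT j₁-iT compT dom-compT cod-compT j₁-compT =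
  compT-unitˡ dom-iT (p₁∘universal≈h₁ _) (p₂∘universal≈h₂ _) ,
  ≈-sym (compT-unitʳ cod-iT (p₁∘universal≈h₁ _) (p₂∘universal≈h₂ _))
  where
  open VStuff V
  open TensorOneProperties V T using (T₂)
  open Pullback T₂
  open TensorOneProperties.UnitLaws V T j₂ π₁-j₂ π₂-j₂ iT j₁-iT compT dom-compT cod-compT j₁-compT
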